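{- Let $P_n$ be the path of order $n\ge 3$, $G_1,G_2$ disjoint copies of $P_n$, and $f_0:V(G_1)\to V(G_2)$ a constant function. Then $Z(C(P_n,f_0))=2$.
   Context: Zero forcing: color each vertex of a graph $H$ black or white, with $S$ the initial set of black vertices. The color-change rule turns a white vertex $u_2$ black if $u_2$ is the only white neighbor of some black vertex $u_1$. $S$ is a zero forcing set of $H$ if all vertices become black after finitely many applications of the rule. $Z(H)$ is the minimum size of a zero forcing set of $H$. Functigraph: given disjoint copies $G_1,G_2$ of $G$ and $f:V(G_1)\to V(G_2)$, $C(G,f)$ has vertex set $V(G_1)\cup V(G_2)$ and edge set $E(G_1)\cup E(G_2)\cup\{uv \mid v=f(u)\}$. -}

module Defs where

open import Data.Nat using (ℕ; suc; _≤_)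
open import Data.Fin using (Fin; toℕ)
open import Data.Sum using (_⊎_; inj₁; inj₂)
open import Data.Product using (Σ; _×_; ∃-syntax)
open import Data.Empty using (⊥)
open import Data.List using (List; length)
open import Data.List.Membership.Propositional using (_∈_)
open import Data.List.Relation.Unary.Unique.Propositional using (Unique)
open import Relation.Binary.PropositionalEquality using (_≡_; _≢_)

Rel : Set → Set₁
Rel V = V → V → Set

PathAdj : (n : ℕ) → Rel (Fin n)
PathAdj n i j = (suc (toℕ i) ≡ toℕ j) ⊎ (suc (toℕ j) ≡ toℕ i)

-- Functigraph C(G,f): vertex set V(G₁) ∪ V(G₂) (= V ⊎ V), edges
-- E(G₁) ∪ E(G₂) ∪ { u v | v = f(u) }  (undirected).
Functigraph : {V : Set} → Rel V → (V → V) → Rel (V ⊎ V)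
Functigraph G f (inj₁ a) (inj₁ b) = G a b
Functigraph G f (inj₂ a) (inj₂ b) = G a b
Functigraph G f (inj₁ u) (inj₂ v) = v ≡ f u
Functigraph G f (inj₂ v) (inj₁ u) = v ≡ f u

-- Vertices that eventually become black starting from the black set S,
-- under the color-change rule: if u₁ is black and u₂ is its only white
-- neighbour, u₂ turns black.  (Least set closed under the rule.)
data Black {V : Set} (H : Rel V) (S : List V) : V → Set where
  initial : ∀ {v} → v ∈ S → Black H S v
  force   : ∀ {u₁ u₂} → Black H S u₁ → H u₁ u₂ →
            (∀ w → H u₁ w → w ≢ u₂ → Black H S w) → Black H S u₂

ZeroForcingSet : {V : Set} → Rel V → List V → Set
ZeroForcingSet {V} H S = ∀ (v : V) → Black H S v

ZeroForcingNumberIs : {V : Set} → Rel V → ℕ → Set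
ZeroForcingNumberIs {V} H k =
  (∃[ S ] (Unique S × length S ≡ k × ZeroForcingSet H S)) ×
  (∀ (S : List V) → Unique S → ZeroForcingSet H S → k ≤ length S)

module Submission where

-- Upper bound: from the two left endpoints, first walk along G₂ up to the common image c of f₀
-- (none of these vertices has a neighbour in G₁), then along all of G₁ (the only off-path
-- neighbour of each vertex is c), and finally along all of G₂ (its off-path neighbours lie in G₁).
-- Lower bound: a single black vertex of G₁ can force nothing, having at least two white neighbours;
-- a single black vertex of G₂ never forces into G₁, since the only vertex of G₂ adjacent to some
-- x ∈ G₁ is c, and c is also adjacent to the G₁-neighbours of x.

open import Defs
open import Data.Nat using (ℕ; zero; suc; _≤_; _<_; s≤s; z≤n)
open import Data.Nat.Properties using (1+n≢n; <-irrefl; m≤n⇒m<n∨m≡n; suc-injective; ≤-refl; ≤-reflexive; <⇒≤; m<n⇒m<1+n)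
open import Data.Fin using (Fin; toℕ; inject₁; _≟_) renaming (zero to fzero; suc to fsuc)
open import Data.Fin.Properties using (toℕ-injective; toℕ-inject₁)
open import Data.Sum using (_⊎_; inj₁; inj₂)
open import Data.Sum.Properties using (≡-dec)
open import Data.Product using (_×_; _,_; ∃-syntax)
open import Data.Empty using (⊥; ⊥-elim)
open import Data.List using (List; []; _∷_; length)
open import Data.List.Relation.Unary.Any using (here; there)
open import Data.List.Relation.Unary.All using (All; []; _∷_; lookup)
open import Data.List.Relation.Unary.Unique.Propositional using (Unique; []; _∷_)
open import Function using (id)
open import Relation.Nullary using (¬_; yes; no)
open import Relation.Unary using (Decidable)
open import Relation.Binary.PropositionalEquality using (_≡_; _≢_; refl; sym; trans; cong; subst)

PathAdj-irreflexive : ∀ {n} {i : Fin n} → ¬ PathAdj n i i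
PathAdj-irreflexive (inj₁ e) = 1+n≢n e
PathAdj-irreflexive (inj₂ e) = 1+n≢n e

path-neighbour : ∀ {m} (i : Fin (suc (suc m))) → ∃[ j ] PathAdj (suc (suc m)) i j
path-neighbour fzero    = fsuc fzero , inj₁ refl
path-neighbour (fsuc k) = inject₁ k , inj₂ (cong suc (toℕ-inject₁ k))

module PathForcing {V : Set} {H : Rel V} {S : List V} {m : ℕ} (ι : Fin (suc m) → V)
  (ι-adj : ∀ {i j} → PathAdj (suc m) i j → H (ι i) (ι j))
  (ι-adj⁻¹ : ∀ {i j} → H (ι i) (ι j) → PathAdj (suc m) i j)
  (start : Black H S (ι fzero)) where

  OffPathBlack : ℕ → Set
  OffPathBlack k = ∀ u w → toℕ u < k → H (ι u) w → (∃[ j ] w ≡ ι j) ⊎ Black H S w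

  BlackPrefix : ℕ → Set
  BlackPrefix k = ∀ i → toℕ i ≤ k → Black H S (ι i)

  OffPathBlack-pred : ∀ {k} → OffPathBlack (suc k) → OffPathBlack k
  OffPathBlack-pred off u w u<k = off u w (m<n⇒m<1+n u<k)

  force-next : ∀ k → OffPathBlack (suc k) → BlackPrefix k →
               ∀ i → toℕ i ≡ suc k → Black H S (ι i)
  force-next k off prefix (fsuc i) i≡k+1 = force (prefix u (≤-reflexive u≡k)) (ι-adj u~i) others
    where
    u = inject₁ i
    u≡k : toℕ u ≡ k
    u≡k = trans (toℕ-inject₁ i) (suc-injective i≡k+1)
    u~i : PathAdj (suc m) u (fsuc i)
    u~i = inj₁ (cong suc (toℕ-inject₁ i))
    others : ∀ w → H (ι u) w → w ≢ ι (fsuc i) → Black H S w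
    others w uw w≢ with off u w (s≤s (≤-reflexive u≡k)) uw
    ... | inj₂ black = black
    ... | inj₁ (j , refl) with ι-adj⁻¹ uw
    ...   | inj₁ u+1≡j = ⊥-elim (w≢ (cong ι (toℕ-injective (trans (sym u+1≡j) (cong suc (toℕ-inject₁ i))))))
    ...   | inj₂ j+1≡u = prefix j (<⇒≤ (subst (suc (toℕ j) ≤_) u≡k (≤-reflexive j+1≡u)))

  black-prefix : ∀ k → OffPathBlack k → BlackPrefix k
  black-prefix zero    _   fzero _ = start
  black-prefix (suc k) off i i≤k+1 with m≤n⇒m<n∨m≡n i≤k+1
  ... | inj₁ (s≤s i≤k) = black-prefix k (OffPathBlack-pred off) i i≤k
  ... | inj₂ i≡k+1     = force-next k off (black-prefix k (OffPathBlack-pred off)) i i≡k+1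

  black-path : (∀ u w → H (ι u) w → (∃[ j ] w ≡ ι j) ⊎ Black H S w) → ∀ i → Black H S (ι i)
  black-path off i = black-prefix (toℕ i) (λ u w _ → off u w) i ≤-refl

-- O is forcing-closed iff its complement is a fort: no vertex of O has exactly one neighbour outside O.
ForcingClosed : {V : Set} → Rel V → (V → Set) → Set
ForcingClosed H O = ∀ {u x} → O u → H u x → ¬ O x → ∃[ y ] H u y × ¬ O y × y ≢ x

module _ {V : Set} {H : Rel V} {O : V → Set} (O? : Decidable O) (closed : ForcingClosed H O) where

  Black⊆ForcingClosed : ∀ {S v} → All O S → Black H S v → O v
  Black⊆ForcingClosed S⊆O (initial v∈S) = lookup S⊆O v∈S
  Black⊆ForcingClosed S⊆O (force {u₂ = v} b uv others) with O? v
  ... | yes Ov = Ov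
  ... | no ¬Ov =
    let y , uy , ¬Oy , y≢v = closed (Black⊆ForcingClosed S⊆O b) uv ¬Ov
    in  ⊥-elim (¬Oy (Black⊆ForcingClosed S⊆O (others y uy y≢v)))

  ¬ZeroForcingSet-inside : ∀ {S v} → All O S → ¬ O v → ¬ ZeroForcingSet H S
  ¬ZeroForcingSet-inside S⊆O ¬Ov zfs = ¬Ov (Black⊆ForcingClosed S⊆O (zfs _))

module UpperBound {m : ℕ} (f₀ : Fin (suc m) → Fin (suc m)) (const : ∀ x y → f₀ x ≡ f₀ y) where

  private
    H = Functigraph (PathAdj (suc m)) f₀

  seeds : List (Fin (suc m) ⊎ Fin (suc m))
  seeds = inj₁ fzero ∷ inj₂ fzero ∷ []

  seeds-unique : Unique seeds
  seeds-unique = ((λ ()) ∷ []) ∷ [] ∷ []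

  black₂-upTo-image : ∀ i → toℕ i ≤ toℕ (f₀ fzero) → Black H seeds (inj₂ i)
  black₂-upTo-image = PathForcing.black-prefix inj₂ id id (initial (there (here refl))) _ off
    where
    off : ∀ u w → toℕ u < toℕ (f₀ fzero) → H (inj₂ u) w → (∃[ j ] w ≡ inj₂ j) ⊎ Black H seeds w
    off u (inj₂ j) _   _    = inj₁ (j , refl)
    off u (inj₁ b) u<c u≡fb = ⊥-elim (<-irrefl (cong toℕ (trans u≡fb (const b fzero))) u<c)

  black₁ : ∀ i → Black H seeds (inj₁ i)
  black₁ = PathForcing.black-path inj₁ id id (initial (here refl)) off
    where
    off : ∀ u w → H (inj₁ u) w → (∃[ j ] w ≡ inj₁ j) ⊎ Black H seeds w
    off u (inj₁ j) _    = inj₁ (j , refl)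
    off u (inj₂ v) v≡fu = inj₂ (subst (λ z → Black H seeds (inj₂ z)) (sym (trans v≡fu (const u fzero)))
                                      (black₂-upTo-image (f₀ fzero) ≤-refl))

  black₂ : ∀ i → Black H seeds (inj₂ i)
  black₂ = PathForcing.black-path inj₂ id id (initial (there (here refl))) off
    where
    off : ∀ u w → H (inj₂ u) w → (∃[ j ] w ≡ inj₂ j) ⊎ Black H seeds w
    off u (inj₂ j) _ = inj₁ (j , refl)
    off u (inj₁ b) _ = inj₂ (black₁ b)

  seeds-zeroForcing : ZeroForcingSet H seeds
  seeds-zeroForcing (inj₁ i) = black₁ i
  seeds-zeroForcing (inj₂ i) = black₂ i

module LowerBound {m : ℕ} (f₀ : Fin (suc (suc m)) → Fin (suc (suc m))) (const : ∀ x y → f₀ x ≡ f₀ y) where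

  private
    n = suc (suc m)
    H = Functigraph (PathAdj n) f₀

  neighbour-distinct : ∀ {i j} → PathAdj n i j → _≢_ {A = Fin n ⊎ Fin n} (inj₁ j) (inj₁ i)
  neighbour-distinct i~j refl = PathAdj-irreflexive i~j

  InCopy₂ : Fin n ⊎ Fin n → Set
  InCopy₂ v = ∃[ j ] v ≡ inj₂ j

  InCopy₂? : Decidable InCopy₂
  InCopy₂? (inj₁ _) = no λ ()
  InCopy₂? (inj₂ j) = yes (j , refl)

  copy₂-forcingClosed : ForcingClosed H InCopy₂
  copy₂-forcingClosed {inj₂ _} {inj₂ x} _ _    ¬Ox = ⊥-elim (¬Ox (x , refl))
  copy₂-forcingClosed {inj₂ z} {inj₁ b} _ z≡fb _   =
    let j , b~j = path-neighbour b
    in  inj₁ j , trans z≡fb (const b j) , (λ ()) , neighbour-distinct b~j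

  singleton₁-forcingClosed : ∀ i → ForcingClosed H (_≡ inj₁ i)
  singleton₁-forcingClosed i {x = inj₁ _} refl _ _ = inj₂ (f₀ i) , refl , (λ ()) , λ ()
  singleton₁-forcingClosed i {x = inj₂ _} refl _ _ =
    let j , i~j = path-neighbour i
    in  inj₁ j , i~j , neighbour-distinct i~j , λ ()

  zeroForcingSet-size≥2 : ∀ S → Unique S → ZeroForcingSet H S → 2 ≤ length S
  zeroForcingSet-size≥2 [] _ zfs =
    ⊥-elim (¬ZeroForcingSet-inside {O = λ _ → ⊥} (λ _ → no id) (λ ()) {v = inj₁ fzero} [] id zfs)
  zeroForcingSet-size≥2 (inj₁ i ∷ []) _ zfs =
    ⊥-elim (¬ZeroForcingSet-inside (λ v → ≡-dec _≟_ _≟_ v (inj₁ i)) (singleton₁-forcingClosed i)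
                                   {v = inj₂ fzero} (refl ∷ []) (λ ()) zfs)
  zeroForcingSet-size≥2 (inj₂ i ∷ []) _ zfs =
    ⊥-elim (¬ZeroForcingSet-inside InCopy₂? copy₂-forcingClosed {v = inj₁ fzero} ((i , refl) ∷ []) (λ ()) zfs)
  zeroForcingSet-size≥2 (_ ∷ _ ∷ _) _ _ = s≤s (s≤s z≤n)

proposition6p5 : (n : ℕ) → 3 ≤ n → (f₀ : Fin n → Fin n) →
    (∀ x y → f₀ x ≡ f₀ y) →
    ZeroForcingNumberIs (Functigraph (PathAdj n) f₀) 2
proposition6p5 (suc (suc m)) (s≤s (s≤s _)) f₀ const =
  (seeds , seeds-unique , refl , seeds-zeroForcing) , zeroForcingSet-size≥2
  where
  open UpperBound f₀ const
  open LowerBound f₀ const
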